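{- Let $k$ be a natural number and suppose $\varphi \rhd \psi$. (1) If $\psi \in \mathrm{E}_k^+$, then $\varphi \in \mathrm{E}_k^+$. (2) If $\psi \in \mathrm{U}_k^+$, then $\varphi \in \mathrm{U}_k^+$.
   Context: Fix an arbitrary first-order language whose logical symbols are $\forall, \exists, \to, \land, \lor, \perp$; $\mathrm{FV}(\varphi)$ is the set of free variables of $\varphi$. Alternation paths: finite sequences of $+$ and $-$ in which $+$ and $-$ alternate. For such $s$, $i(s)$ is its first symbol if $s$ is nonempty and a special symbol $\times$ if $s=\langle\,\rangle$; $s^\perp$ swaps $+$ and $-$; $l(s)$ is its length; $+s$, $-s$ denote prepending. $\mathrm{Alt}(\varphi)$: if $\varphi$ is quantifier-free, $\{\langle\,\rangle\}$; otherwise $\mathrm{Alt}(\varphi_1 \land \varphi_2)=\mathrm{Alt}(\varphi_1 \lor \varphi_2) = \mathrm{Alt}(\varphi_1)\cup\mathrm{Alt}(\varphi_2)$; $\mathrm{Alt}(\varphi_1\to\varphi_2) = \{s^\perp : s\in\mathrm{Alt}(\varphi_1)\}\cup\mathrm{Alt}(\varphi_2)$; $\mathrm{Alt}(\forall x\varphi_1) = \{s\in\mathrm{Alt}(\varphi_1): i(s)=-\}\cup\{ -s: s\in\mathrm{Alt}(\varphi_1), i(s)\neq -\}$; $\mathrm{Alt}(\exists x\varphi_1) = \{s\in\mathrm{Alt}(\varphi_1): i(s)=+\}\cup\{+s: s\in\mathrm{Alt}(\varphi_1), i(s)\neq +\}$. $\deg(\varphi)=\max\{l(s): s\in\mathrm{Alt}(\varphi)\}$.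 Classes: $\mathrm{F}_k=\{\varphi:\deg(\varphi)=k\}$; $\mathrm{U}_0=\mathrm{E}_0=\mathrm{F}_0$; $\mathrm{U}_{k+1}=\{\varphi\in\mathrm{F}_{k+1}: i(s)=- \text{ for all } s\in\mathrm{Alt}(\varphi) \text{ with } l(s)=k+1\}$; $\mathrm{E}_{k+1}$ likewise with $+$; $\mathrm{U}_k^+=\mathrm{U}_k\cup\bigcup_{i<k}\mathrm{F}_i$; $\mathrm{E}_k^+=\mathrm{E}_k\cup\bigcup_{i<k}\mathrm{F}_i$. Prenex transformation: $\varphi\rhd\psi$ means that for some formulas $\xi,\delta$, a variable $x\notin\mathrm{FV}(\delta)$, a variable $y$ not occurring in $\xi$, and $Q\in\{\forall,\exists\}$, $(\varphi,\psi)$ is one of: $(\exists x\xi(x)\to\delta, \forall x(\xi(x)\to\delta))$; $(\forall x\xi(x)\to\delta, \exists x(\xi(x)\to\delta))$; $(\delta\to Qx\,\xi(x), Qx(\delta\to\xi(x)))$; $(Qx\,\xi(x)\land\delta, Qx(\xi(x)\land\delta))$; $(\delta\land Qx\,\xi(x), Qx(\delta\land\xi(x)))$; $(Qx\,\xi(x)\lor\delta, Qx(\xi(x)\lor\delta))$; $(\delta\lor Qx\,\xi(x), Qx(\delta\lor\xi(x)))$; $(Qx\,\xi(x), Qy\,\xi(y))$, with $\xi(y)$ the substitution of $y$ for free $x$. -}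

module Defs where

open import Data.Nat using (ℕ; zero; suc; _⊔_; _<_)
open import Data.Fin using (Fin)
open import Data.Bool using (Bool; true; false; if_then_else_; _∧_)
open import Data.List using (List; []; _∷_; [_]; _++_; map; length; foldr; filter)
open import Data.Maybe using (Maybe; just; nothing)
open import Data.Product using (Σ; ∃; _×_; _,_)
open import Data.Sum using (_⊎_)
open import Data.List.Membership.Propositional using (_∈_)
open import Relation.Nullary using (¬_)
open import Relation.Binary.PropositionalEquality using (_≡_)

-- An arbitrary first-order language (function and relation symbols
-- with arities; constants are 0-ary function symbols; equality, if
-- present, is one of the relation symbols).  Variables are ℕ.

record Signature : Set₁ where
  field
    Fun   : Set
    Rel   : Set
    funAr : Fun → ℕ
    relAr : Rel → ℕ

module Syntax (L : Signature) where
  open Signature L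

  data Term : Set where
    var : ℕ → Term
    app : (f : Fun) → (Fin (funAr f) → Term) → Term

  data Formula : Set where
    rel  : (R : Rel) → (Fin (relAr R) → Term) → Formula
    ⊥'   : Formula
    _⇒_  : Formula → Formula → Formula
    _∧'_ : Formula → Formula → Formula
    _∨'_ : Formula → Formula → Formula
    ∀'   : ℕ → Formula → Formula
    ∃'   : ℕ → Formula → Formula

  data Quant : Set where
    Qall Qex : Quant

  quant : Quant → ℕ → Formula → Formula
  quant Qall x φ = ∀' x φ
  quant Qex  x φ = ∃' x φ

  data _occT_ (x : ℕ) : Term → Set where
    here : x occT var x
    arg  : ∀ {f ts} (i : Fin (funAr f)) → x occT ts i → x occT app f ts

  data _∈FV_ (x : ℕ) : Formula → Set where
    rel  : ∀ {R ts} (i : Fin (relAr R)) → x occT ts i → x ∈FV rel R ts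
    ⇒l   : ∀ {φ ψ} → x ∈FV φ → x ∈FV (φ ⇒ ψ)
    ⇒r   : ∀ {φ ψ} → x ∈FV ψ → x ∈FV (φ ⇒ ψ)
    ∧l   : ∀ {φ ψ} → x ∈FV φ → x ∈FV (φ ∧' ψ)
    ∧r   : ∀ {φ ψ} → x ∈FV ψ → x ∈FV (φ ∧' ψ)
    ∨l   : ∀ {φ ψ} → x ∈FV φ → x ∈FV (φ ∨' ψ)
    ∨r   : ∀ {φ ψ} → x ∈FV ψ → x ∈FV (φ ∨' ψ)
    ∀b   : ∀ {y φ} → ¬ (x ≡ y) → x ∈FV φ → x ∈FV ∀' y φ
    ∃b   : ∀ {y φ} → ¬ (x ≡ y) → x ∈FV φ → x ∈FV ∃' y φ

  data _occurs_ (x : ℕ) : Formula → Set where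
    rel  : ∀ {R ts} (i : Fin (relAr R)) → x occT ts i → x occurs rel R ts
    ⇒l   : ∀ {φ ψ} → x occurs φ → x occurs (φ ⇒ ψ)
    ⇒r   : ∀ {φ ψ} → x occurs ψ → x occurs (φ ⇒ ψ)
    ∧l   : ∀ {φ ψ} → x occurs φ → x occurs (φ ∧' ψ)
    ∧r   : ∀ {φ ψ} → x occurs ψ → x occurs (φ ∧' ψ)
    ∨l   : ∀ {φ ψ} → x occurs φ → x occurs (φ ∨' ψ)
    ∨r   : ∀ {φ ψ} → x occurs ψ → x occurs (φ ∨' ψ)
    ∀v   : ∀ {φ} → x occurs ∀' x φ
    ∃v   : ∀ {φ} → x occurs ∃' x φ
    ∀b   : ∀ {y φ} → x occurs φ → x occurs ∀' y φ
    ∃b   : ∀ {y φ} → x occurs φ → x occurs ∃' y φ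

  -- substitution of the variable y for the free occurrences of x
  -- (capture is irrelevant in its only use, where y does not occur)
  renT : ℕ → ℕ → Term → Term
  renT x y (var z) with x Data.Nat.≟ z
  ... | Relation.Nullary.yes _ = var y
  ... | Relation.Nullary.no  _ = var z
  renT x y (app f ts) = app f (λ i → renT x y (ts i))

  ren : ℕ → ℕ → Formula → Formula
  ren x y (rel R ts) = rel R (λ i → renT x y (ts i))
  ren x y ⊥' = ⊥'
  ren x y (φ ⇒ ψ) = ren x y φ ⇒ ren x y ψ
  ren x y (φ ∧' ψ) = ren x y φ ∧' ren x y ψ
  ren x y (φ ∨' ψ) = ren x y φ ∨' ren x y ψ
  ren x y (∀' z φ) with x Data.Nat.≟ z
  ... | Relation.Nullary.yes _ = ∀' z φ
  ... | Relation.Nullary.no  _ = ∀' z (ren x y φ)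
  ren x y (∃' z φ) with x Data.Nat.≟ z
  ... | Relation.Nullary.yes _ = ∃' z φ
  ... | Relation.Nullary.no  _ = ∃' z (ren x y φ)

  data Sign : Set where
    + - : Sign

  -- an alternation path (the elements of Alt φ are automatically
  -- alternating sequences)
  Path : Set
  Path = List Sign

  -- i(s): nothing plays the role of the special symbol ×
  i : Path → Maybe Sign
  i []      = nothing
  i (c ∷ _) = just c

  flip : Sign → Sign
  flip + = -
  flip - = +

  _⊥ₚ : Path → Path
  s ⊥ₚ = map flip s

  isQF : Formula → Bool
  isQF (rel R ts) = true
  isQF ⊥' = true
  isQF (φ ⇒ ψ) = isQF φ ∧ isQF ψ
  isQF (φ ∧' ψ) = isQF φ ∧ isQF ψ
  isQF (φ ∨' ψ) = isQF φ ∧ isQF ψ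
  isQF (∀' _ _) = false
  isQF (∃' _ _) = false

  isMinus isPlus : Path → Bool
  isMinus (- ∷ _) = true
  isMinus _       = false
  isPlus  (+ ∷ _) = true
  isPlus  _       = false

  quantAlt : Sign → (Path → Bool) → List Path → List Path
  quantAlt c is [] = []
  quantAlt c is (s ∷ A) = (if is s then s else c ∷ s) ∷ quantAlt c is A

  Alt : Formula → List Path
  Alt φ = if isQF φ then [ [] ] else Alt' φ
    where
    Alt' : Formula → List Path
    Alt' (φ₁ ∧' φ₂) = Alt φ₁ ++ Alt φ₂
    Alt' (φ₁ ∨' φ₂) = Alt φ₁ ++ Alt φ₂
    Alt' (φ₁ ⇒ φ₂)  = map _⊥ₚ (Alt φ₁) ++ Alt φ₂
    Alt' (∀' x φ₁)  = quantAlt - isMinus (Alt φ₁)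
    Alt' (∃' x φ₁)  = quantAlt + isPlus (Alt φ₁)
    Alt' _          = [ [] ]

  deg : Formula → ℕ
  deg φ = foldr _⊔_ 0 (map length (Alt φ))

  F : ℕ → Formula → Set
  F k φ = deg φ ≡ k

  U E : ℕ → Formula → Set
  U zero    φ = F zero φ
  U (suc k) φ = F (suc k) φ ×
    (∀ s → s ∈ Alt φ → length s ≡ suc k → i s ≡ just -)
  E zero    φ = F zero φ
  E (suc k) φ = F (suc k) φ ×
    (∀ s → s ∈ Alt φ → length s ≡ suc k → i s ≡ just +)

  U⁺ E⁺ : ℕ → Formula → Set
  U⁺ k φ = U k φ ⊎ Σ ℕ (λ j → j < k × F j φ)
  E⁺ k φ = E k φ ⊎ Σ ℕ (λ j → j < k × F j φ)

  data _▷_ : Formula → Formula → Set where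
    ∃⇒ : ∀ {x ξ δ} → ¬ (x ∈FV δ) → ((∃' x ξ) ⇒ δ) ▷ ∀' x (ξ ⇒ δ)
    ∀⇒ : ∀ {x ξ δ} → ¬ (x ∈FV δ) → ((∀' x ξ) ⇒ δ) ▷ ∃' x (ξ ⇒ δ)
    ⇒Q : ∀ {Q x ξ δ} → ¬ (x ∈FV δ) → (δ ⇒ quant Q x ξ) ▷ quant Q x (δ ⇒ ξ)
    Q∧ : ∀ {Q x ξ δ} → ¬ (x ∈FV δ) → (quant Q x ξ ∧' δ) ▷ quant Q x (ξ ∧' δ)
    ∧Q : ∀ {Q x ξ δ} → ¬ (x ∈FV δ) → (δ ∧' quant Q x ξ) ▷ quant Q x (δ ∧' ξ)
    Q∨ : ∀ {Q x ξ δ} → ¬ (x ∈FV δ) → (quant Q x ξ ∨' δ) ▷ quant Q x (ξ ∨' δ)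
    ∨Q : ∀ {Q x ξ δ} → ¬ (x ∈FV δ) → (δ ∨' quant Q x ξ) ▷ quant Q x (δ ∨' ξ)
    rn : ∀ {Q x y ξ} → ¬ (y occurs ξ) → quant Q x ξ ▷ quant Q y (ren x y ξ)

-- Membership in E⁺_k (resp. U⁺_k) is a condition on each alternation path
-- separately: it must be shorter than k, or have length k and begin with +
-- (resp. −).  In a prenex step φ ▷ ψ the quantifier moved outwards puts its
-- sign in front of the paths it now governs (absorbed if already there), so
-- every path of φ is a path of ψ with at most its first sign deleted; for a
-- quantifier leaving an antecedent this uses that flipping a path commutes
-- with prefixing the dual quantifier.  Renaming a bound variable leaves Alt
-- unchanged.  Deleting the first sign keeps a path within the bound, so φ
-- inherits the class of ψ.
module Submission where

open import Defs
open import Data.Bool using (Bool; true; false; _∧_; if_then_else_)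
open import Data.Empty using (⊥-elim)
open import Data.List using (List; []; _∷_; [_]; _++_; map; length)
open import Data.List.Membership.Propositional using (_∈_)
open import Data.List.Properties using (foldr-forcesᵇ; foldr-preservesᵇ)
open import Data.List.Relation.Unary.All as All using (All; []; _∷_)
open import Data.List.Relation.Unary.All.Properties using (map⁺; map⁻; ++⁺; ++⁻)
open import Data.Maybe using (just)
open import Data.Maybe.Properties using (just-injective)
open import Data.Nat using (ℕ; zero; suc; _⊔_; _<_; _≤_; _≟_; z≤n)
open import Data.Nat.Properties
  using (≤-refl; ≤-reflexive; <-trans; ≤-<-trans; <⇒≤; n<1+n; <-irrefl; m≤n⇒m<n∨m≡n; ⊔-lub; m⊔n≤o⇒m≤o; m⊔n≤o⇒n≤o)
open import Data.Product using (Σ; _×_; _,_; proj₁; map₁; uncurry)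
open import Data.Sum using (_⊎_; inj₁; inj₂)
open import Data.Unit using (⊤; tt)
open import Function using (_∘_; id; _⇔_; mk⇔; Equivalence)
open import Relation.Nullary using (yes; no)
open import Relation.Binary.PropositionalEquality using (_≡_; refl; cong; cong₂; subst)

open Equivalence using (to; from)

module _ {L : Signature} where
  open Syntax L

  deg≤⇔ : ∀ {n} φ → deg φ ≤ n ⇔ All (λ s → length s ≤ n) (Alt φ)
  deg≤⇔ φ = mk⇔
    (map⁻ ∘ foldr-forcesᵇ {P = _≤ _} {f = _⊔_} ⊔-bounded 0 _)
    (foldr-preservesᵇ {P = _≤ _} {f = _⊔_} ⊔-lub z≤n ∘ map⁺)
    where
    ⊔-bounded : ∀ {o} m n → m ⊔ n ≤ o → m ≤ o × n ≤ o
    ⊔-bounded m n m⊔n≤o = m⊔n≤o⇒m≤o m n m⊔n≤o , m⊔n≤o⇒n≤o m n m⊔n≤o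

  deg≤⇒length≤ : ∀ {n s} φ → deg φ ≤ n → s ∈ Alt φ → length s ≤ n
  deg≤⇒length≤ φ deg≤n = All.lookup (to (deg≤⇔ φ) deg≤n)

  Fits : Sign → ℕ → Path → Set
  Fits c k []      = ⊤
  Fits c k (d ∷ s) = suc (length s) < k ⊎ (suc (length s) ≡ k × d ≡ c)

  AllFit : Sign → ℕ → Formula → Set
  AllFit c k φ = All (Fits c k) (Alt φ)

  Fits-tail : ∀ {c k d} s → Fits c k (d ∷ s) → Fits c k s
  Fits-tail []      _                 = tt
  Fits-tail (e ∷ s) (inj₁ 2+s<k)      = inj₁ (<-trans (n<1+n _) 2+s<k)
  Fits-tail (e ∷ s) (inj₂ (refl , _)) = inj₁ (n<1+n _)

  Fits⇒length≤ : ∀ {c k} s → Fits c k s → length s ≤ k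
  Fits⇒length≤ []      _                 = z≤n
  Fits⇒length≤ (d ∷ s) (inj₁ 1+s<k)      = <⇒≤ 1+s<k
  Fits⇒length≤ (d ∷ s) (inj₂ (refl , _)) = ≤-refl

  -- Class + and Class - are E and U; they agree definitionally once k is
  -- a constructor.
  Class : Sign → ℕ → Formula → Set
  Class c zero    φ = F zero φ
  Class c (suc k) φ = F (suc k) φ × (∀ s → s ∈ Alt φ → length s ≡ suc k → i s ≡ just c)

  Class⁺ : Sign → ℕ → Formula → Set
  Class⁺ c k φ = Class c k φ ⊎ Σ ℕ (λ j → j < k × F j φ)

  Class⁺⇒Fits : ∀ {c k s} φ → Class⁺ c k φ → s ∈ Alt φ → Fits c k s
  Class⁺⇒Fits {s = []}    φ _ _ = tt
  Class⁺⇒Fits {s = d ∷ t} φ (inj₂ (j , j<k , deg≡j)) s∈ =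
    inj₁ (≤-<-trans (deg≤⇒length≤ φ (≤-reflexive deg≡j) s∈) j<k)
  Class⁺⇒Fits {k = zero} {d ∷ t} φ (inj₁ deg≡0) s∈
    with () ← deg≤⇒length≤ φ (≤-reflexive deg≡0) s∈
  Class⁺⇒Fits {k = suc k} {d ∷ t} φ (inj₁ (deg≡1+k , leading)) s∈
    with m≤n⇒m<n∨m≡n (deg≤⇒length≤ φ (≤-reflexive deg≡1+k) s∈)
  ... | inj₁ 1+t<k = inj₁ 1+t<k
  ... | inj₂ 1+t≡k = inj₂ (1+t≡k , just-injective (leading (d ∷ t) s∈ 1+t≡k))

  AllFit⇒Class⁺ : ∀ {c} k φ → AllFit c k φ → Class⁺ c k φ
  AllFit⇒Class⁺ k φ fits with m≤n⇒m<n∨m≡n (from (deg≤⇔ φ) (All.map (Fits⇒length≤ _) fits))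
  ... | inj₁ deg<k = inj₂ (deg φ , deg<k , refl)
  AllFit⇒Class⁺ zero    φ fits | inj₂ deg≡0   = inj₁ deg≡0
  AllFit⇒Class⁺ (suc k) φ fits | inj₂ deg≡1+k = inj₁ (deg≡1+k , λ s s∈ → leads s (All.lookup fits s∈))
    where
    leads : ∀ {c} s → Fits c (suc k) s → length s ≡ suc k → i s ≡ just c
    leads (d ∷ t) (inj₁ 1+t<1+k)    1+t≡1+k = ⊥-elim (<-irrefl 1+t≡1+k 1+t<1+k)
    leads (d ∷ t) (inj₂ (_ , refl)) _       = refl

  Class⁺⇔AllFit : ∀ c k φ → Class⁺ c k φ ⇔ AllFit c k φ
  Class⁺⇔AllFit c k φ = mk⇔ (λ φ∈ → All.tabulate (Class⁺⇒Fits φ φ∈)) (AllFit⇒Class⁺ k φ)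

  E⁺⇔AllFit : ∀ k φ → E⁺ k φ ⇔ AllFit + k φ
  E⁺⇔AllFit zero    = Class⁺⇔AllFit + zero
  E⁺⇔AllFit (suc k) = Class⁺⇔AllFit + (suc k)

  U⁺⇔AllFit : ∀ k φ → U⁺ k φ ⇔ AllFit - k φ
  U⁺⇔AllFit zero    = Class⁺⇔AllFit - zero
  U⁺⇔AllFit (suc k) = Class⁺⇔AllFit - (suc k)

  quantPath : Quant → Path → Path
  quantPath Qall s = if isMinus s then s else - ∷ s
  quantPath Qex  s = if isPlus s then s else + ∷ s

  dual : Quant → Quant
  dual Qall = Qex
  dual Qex  = Qall

  quantAlt≡map : ∀ c is A → quantAlt c is A ≡ map (λ s → if is s then s else c ∷ s) A
  quantAlt≡map c is []      = refl
  quantAlt≡map c is (s ∷ A) = cong (_ ∷_) (quantAlt≡map c is A)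

  Alt-quant : ∀ Q x ξ → Alt (quant Q x ξ) ≡ map (quantPath Q) (Alt ξ)
  Alt-quant Qall x ξ = quantAlt≡map - isMinus (Alt ξ)
  Alt-quant Qex  x ξ = quantAlt≡map + isPlus (Alt ξ)

  All-quant : ∀ {P : Path → Set} Q x ξ → All P (Alt (quant Q x ξ)) ⇔ All (P ∘ quantPath Q) (Alt ξ)
  All-quant {P} Q x ξ rewrite Alt-quant Q x ξ = mk⇔ map⁻ map⁺

  Fits-quantPath : ∀ {c k} Q s → Fits c k (quantPath Q s) → Fits c k s
  Fits-quantPath Qall []      _ = tt
  Fits-quantPath Qall (+ ∷ s) = Fits-tail (+ ∷ s)
  Fits-quantPath Qall (- ∷ s) = id
  Fits-quantPath Qex  []      _ = tt
  Fits-quantPath Qex  (+ ∷ s) = id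
  Fits-quantPath Qex  (- ∷ s) = Fits-tail (- ∷ s)

  quantPath-dual : ∀ Q s → quantPath (dual Q) (s ⊥ₚ) ≡ quantPath Q s ⊥ₚ
  quantPath-dual Qall []      = refl
  quantPath-dual Qall (+ ∷ s) = refl
  quantPath-dual Qall (- ∷ s) = refl
  quantPath-dual Qex  []      = refl
  quantPath-dual Qex  (+ ∷ s) = refl
  quantPath-dual Qex  (- ∷ s) = refl

  Alt-QF : ∀ φ → isQF φ ≡ true → Alt φ ≡ [ [] ]
  Alt-QF φ qf rewrite qf = refl

  ifQF : Bool → List Path → List Path
  ifQF qf A = if qf then [ [] ] else A

  -- For quantifier-free a and b, Alt yields [ [] ] rather than [ [] ] ++ [ [] ],
  -- which All cannot tell apart.
  All-binary : ∀ {P : Path → Set} a b {A} → (isQF a ≡ true → A ≡ [ [] ]) →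
    All P (ifQF (isQF a ∧ isQF b) (A ++ Alt b)) ⇔ (All P A × All P (Alt b))
  All-binary a b A≡ with isQF a in qfa | isQF b in qfb
  ... | true  | true  rewrite A≡ refl = mk⇔ (λ p → p , p) proj₁
  ... | true  | false = mk⇔ (++⁻ _) (uncurry ++⁺)
  ... | false | _     = mk⇔ (++⁻ _) (uncurry ++⁺)

  AltSplits : (Formula → Formula → Formula) → (Path → Path) → Set₁
  AltSplits _∙_ f = ∀ {P : Path → Set} a b → All P (Alt (a ∙ b)) ⇔ (All (P ∘ f) (Alt a) × All P (Alt b))

  ∧-splits : AltSplits _∧'_ id
  ∧-splits a b = All-binary a b (Alt-QF a)

  ∨-splits : AltSplits _∨'_ id
  ∨-splits a b = All-binary a b (Alt-QF a)

  ⇒-splits : AltSplits _⇒_ _⊥ₚ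
  ⇒-splits a b = mk⇔ (map₁ map⁻ ∘ to splits) (from splits ∘ map₁ map⁺)
    where splits = All-binary a b (cong (map _⊥ₚ) ∘ Alt-QF a)

  isQF-ren : ∀ x y φ → isQF (ren x y φ) ≡ isQF φ
  isQF-ren x y (rel R ts) = refl
  isQF-ren x y ⊥'         = refl
  isQF-ren x y (a ⇒ b)    = cong₂ _∧_ (isQF-ren x y a) (isQF-ren x y b)
  isQF-ren x y (a ∧' b)   = cong₂ _∧_ (isQF-ren x y a) (isQF-ren x y b)
  isQF-ren x y (a ∨' b)   = cong₂ _∧_ (isQF-ren x y a) (isQF-ren x y b)
  isQF-ren x y (∀' z a) with x ≟ z
  ... | yes _ = refl
  ... | no  _ = refl
  isQF-ren x y (∃' z a) with x ≟ z
  ... | yes _ = refl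
  ... | no  _ = refl

  Alt-ren : ∀ x y φ → Alt (ren x y φ) ≡ Alt φ
  Alt-ren x y (rel R ts) = refl
  Alt-ren x y ⊥'         = refl
  Alt-ren x y (a ⇒ b)    = cong₂ ifQF (isQF-ren x y (a ⇒ b))
    (cong₂ (λ A B → map _⊥ₚ A ++ B) (Alt-ren x y a) (Alt-ren x y b))
  Alt-ren x y (a ∧' b)   = cong₂ ifQF (isQF-ren x y (a ∧' b)) (cong₂ _++_ (Alt-ren x y a) (Alt-ren x y b))
  Alt-ren x y (a ∨' b)   = cong₂ ifQF (isQF-ren x y (a ∨' b)) (cong₂ _++_ (Alt-ren x y a) (Alt-ren x y b))
  Alt-ren x y (∀' z a) with x ≟ z
  ... | yes _ = refl
  ... | no  _ = cong (quantAlt - isMinus) (Alt-ren x y a)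
  Alt-ren x y (∃' z a) with x ≟ z
  ... | yes _ = refl
  ... | no  _ = cong (quantAlt + isPlus) (Alt-ren x y a)

  module _ {c : Sign} {k : ℕ} (_∙_ : Formula → Formula → Formula) {f : Path → Path}
           (splits : AltSplits _∙_ f) where

    AllFit-pullˡ : ∀ Q Q′ → (∀ s → quantPath Q′ (f s) ≡ f (quantPath Q s)) →
      ∀ x ξ δ → AllFit c k (quant Q′ x (ξ ∙ δ)) → AllFit c k (quant Q x ξ ∙ δ)
    AllFit-pullˡ Q Q′ commutes x ξ δ fits =
      let fitsξ , fitsδ = to (splits ξ δ) (to (All-quant Q′ x (ξ ∙ δ)) fits)
      in from (splits (quant Q x ξ) δ)
           ( from (All-quant Q x ξ) (All.map (λ {s} → subst (Fits c k) (commutes s)) fitsξ)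
           , All.map (Fits-quantPath Q′ _) fitsδ )

    AllFit-pullʳ : ∀ Q x ξ δ → AllFit c k (quant Q x (δ ∙ ξ)) → AllFit c k (δ ∙ quant Q x ξ)
    AllFit-pullʳ Q x ξ δ fits =
      let fitsδ , fitsξ = to (splits δ ξ) (to (All-quant Q x (δ ∙ ξ)) fits)
      in from (splits δ (quant Q x ξ))
           (All.map (Fits-quantPath Q _) fitsδ , from (All-quant Q x ξ) fitsξ)

  AllFit-ren : ∀ {c k} Q x y ξ → AllFit c k (quant Q y (ren x y ξ)) → AllFit c k (quant Q x ξ)
  AllFit-ren Q x y ξ fits =
    from (All-quant Q x ξ) (subst (All _) (Alt-ren x y ξ) (to (All-quant Q y (ren x y ξ)) fits))

  ▷-reflects-AllFit : ∀ {c k φ ψ} → φ ▷ ψ → AllFit c k ψ → AllFit c k φ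
  ▷-reflects-AllFit (∃⇒ {x} {ξ} {δ} _) = AllFit-pullˡ _⇒_ ⇒-splits Qex Qall (quantPath-dual Qex) x ξ δ
  ▷-reflects-AllFit (∀⇒ {x} {ξ} {δ} _) = AllFit-pullˡ _⇒_ ⇒-splits Qall Qex (quantPath-dual Qall) x ξ δ
  ▷-reflects-AllFit (Q∧ {Q} {x} {ξ} {δ} _) = AllFit-pullˡ _∧'_ ∧-splits Q Q (λ _ → refl) x ξ δ
  ▷-reflects-AllFit (Q∨ {Q} {x} {ξ} {δ} _) = AllFit-pullˡ _∨'_ ∨-splits Q Q (λ _ → refl) x ξ δ
  ▷-reflects-AllFit (⇒Q {Q} {x} {ξ} {δ} _) = AllFit-pullʳ _⇒_ ⇒-splits Q x ξ δ
  ▷-reflects-AllFit (∧Q {Q} {x} {ξ} {δ} _) = AllFit-pullʳ _∧'_ ∧-splits Q x ξ δ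
  ▷-reflects-AllFit (∨Q {Q} {x} {ξ} {δ} _) = AllFit-pullʳ _∨'_ ∨-splits Q x ξ δ
  ▷-reflects-AllFit (rn {Q} {x} {y} {ξ} _) = AllFit-ren Q x y ξ

lemma4p4 : (L : Signature) → let open Syntax L in
    (k : ℕ) (φ ψ : Formula) → φ ▷ ψ →
    (E⁺ k ψ → E⁺ k φ) × (U⁺ k ψ → U⁺ k φ)
lemma4p4 L k φ ψ φ▷ψ =
    (λ ψ∈E⁺ → from (E⁺⇔AllFit k φ) (▷-reflects-AllFit φ▷ψ (to (E⁺⇔AllFit k ψ) ψ∈E⁺)))
  , (λ ψ∈U⁺ → from (U⁺⇔AllFit k φ) (▷-reflects-AllFit φ▷ψ (to (U⁺⇔AllFit k ψ) ψ∈U⁺)))
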